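{- (Subject reduction.) In the $\mathcal{L}^{\mathcal S}_2$-calculus described in the context, if $\Xi;\Gamma\vdash t:A$ is derivable and $t\to u$, then $\Xi;\Gamma\vdash u:A$ is derivable.
   Context: Let $\mathcal S$ be a semiring. Propositions (modulo $\alpha$-equivalence; $X$ ranges over proposition variables): $A ::= X \mid \mathbf 1 \mid A\multimap A\mid A\otimes A\mid \top\mid \mathbf 0\mid A\,\&\,A\mid A\oplus A\mid\, !A\mid \forall X.A$. $(B/X)A$ is capture-avoiding substitution and $FV$ denotes free proposition variables. Proof-terms (modulo $\alpha$-equivalence; $a\in\mathcal S$): $t ::= x \mid t\boxplus u\mid a\bullet t\mid a.\star\mid \delta_{\mathbf 1}(t,u)\mid \lambda x^A.t\mid t\,u\mid t\otimes u\mid \delta_\otimes(t,x^Ay^B.u)\mid\langle\rangle\mid \delta_{\mathbf 0}(t) \mid \langle t,u\rangle\mid \delta^1_\&(t,x^A.u)\mid\delta^2_\&(t,x^B.u)\mid \mathrm{inl}(t)\mid\mathrm{inr}(t)\mid\delta_\oplus(t,x^A.u,y^B.v)\mid\, !t\mid\delta_!(t,x^A.u)\mid\Lambda X.t\mid t\,A$; here $\boxplus$ is the proof-term sum and $\bullet$ scalar product. $(u/x)t$ and $(B/X)t$ denote substitutions. Sequents are $\Xi;\Gamma\vdash t:A$ where $\Xi$ (non-linear) and $\Gamma$ (linear) are finite sets of declarations $x^B$, and $\Gamma,\Delta$ denotes a disjoint union. Typing rules: $\Xi;x^A\vdash x:A$; $\Xi,x^A;\varnothing\vdash x:A$; from $\Xi;\Gamma\vdash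 t:A$ and $\Xi;\Gamma\vdash u:A$ infer $\Xi;\Gamma\vdash t\boxplus u:A$; from $\Xi;\Gamma\vdash t:A$ infer $\Xi;\Gamma\vdash a\bullet t:A$; $\Xi;\varnothing\vdash a.\star:\mathbf 1$; from $\Xi;\Gamma\vdash t:\mathbf 1$ and $\Xi;\Delta\vdash u:A$ infer $\Xi;\Gamma,\Delta\vdash \delta_{\mathbf 1}(t,u):A$; from $\Xi;\Gamma,x^A\vdash t:B$ infer $\Xi;\Gamma\vdash \lambda x^A.t:A\multimap B$; from $\Xi;\Gamma\vdash t:A\multimap B$ and $\Xi;\Delta\vdash u:A$ infer $\Xi;\Gamma,\Delta\vdash t\,u:B$; from $\Xi;\Gamma\vdash t:A$ and $\Xi;\Delta\vdash u:B$ infer $\Xi;\Gamma,\Delta\vdash t\otimes u:A\otimes B$; from $\Xi;\Gamma\vdash t:A\otimes B$ and $\Xi;\Delta,x^A,y^B\vdash u:C$ infer $\Xi;\Gamma,\Delta\vdash\delta_\otimes(t,x^Ay^B.u):C$; $\Xi;\Gamma\vdash\langle\rangle:\top$ for any $\Gamma$; from $\Xi;\Gamma\vdash t:\mathbf 0$ infer $\Xi;\Gamma,\Delta\vdash\delta_{\mathbf 0}(t):C$; from $\Xi;\Gamma\vdash t:A$ and $\Xi;\Gamma\vdash u:B$ infer $\Xi;\Gamma\vdash\langle t,u\rangle:A\&B$; from $\Xi;\Gamma\vdash t:A\&B$ and $\Xi;\Delta,x^A\vdash u:C$ infer $\Xi;\Gamma,\Delta\vdash\delta^1_\&(t,x^A.u):C$;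 from $\Xi;\Gamma\vdash t:A\&B$ and $\Xi;\Delta,x^B\vdash u:C$ infer $\Xi;\Gamma,\Delta\vdash\delta^2_\&(t,x^B.u):C$; from $\Xi;\Gamma\vdash t:A$ infer $\Xi;\Gamma\vdash\mathrm{inl}(t):A\oplus B$; from $\Xi;\Gamma\vdash t:B$ infer $\Xi;\Gamma\vdash\mathrm{inr}(t):A\oplus B$; from $\Xi;\Gamma\vdash t:A\oplus B$, $\Xi;\Delta,x^A\vdash u:C$ and $\Xi;\Delta,y^B\vdash v:C$ infer $\Xi;\Gamma,\Delta\vdash\delta_\oplus(t,x^A.u,y^B.v):C$; from $\Xi;\varnothing\vdash t:A$ infer $\Xi;\varnothing\vdash\, !t:\,!A$; from $\Xi;\Gamma\vdash t:\,!A$ and $\Xi,x^A;\Delta\vdash u:B$ infer $\Xi;\Gamma,\Delta\vdash\delta_!(t,x^A.u):B$; from $\Xi;\Gamma\vdash t:A$ with $X\notin FV(\Xi,\Gamma)$ infer $\Xi;\Gamma\vdash\Lambda X.t:\forall X.A$; from $\Xi;\Gamma\vdash t:\forall X.B$ infer $\Xi;\Gamma\vdash t\,A:(A/X)B$. One-step reduction $\to$ is the closure under arbitrary proof-term contexts of the rules: $\delta_{\mathbf 1}(a.\star,t)\to a\bullet t$; $(\lambda x^A.t)\,u\to(u/x)t$; $\delta_\otimes(u\otimes v,x^Ay^B.w)\to(u/x,v/y)w$; $\delta^i_\&(\langle t_1,t_2\rangle,x.v)\to(t_i/x)v$ for $i=1,2$; $\delta_\oplus(\mathrm{inl}(t),x^A.v,y^B.w)\to(t/x)v$;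 $\delta_\oplus(\mathrm{inr}(u),x^A.v,y^B.w)\to(u/y)w$; $\delta_!(!t,x^A.u)\to(t/x)u$; $(\Lambda X.t)\,A\to(A/X)t$; $a.\star\boxplus b.\star\to(a+b).\star$; $(\lambda x^A.t)\boxplus(\lambda x^A.u)\to\lambda x^A.(t\boxplus u)$; $\delta_\otimes(t\boxplus u,x^Ay^B.v)\to\delta_\otimes(t,x^Ay^B.v)\boxplus\delta_\otimes(u,x^Ay^B.v)$; $\langle\rangle\boxplus\langle\rangle\to\langle\rangle$; $\langle t,u\rangle\boxplus\langle v,w\rangle\to\langle t\boxplus v,u\boxplus w\rangle$; $\delta_\oplus(t\boxplus u,x^A.v,y^B.w)\to\delta_\oplus(t,x^A.v,y^B.w)\boxplus\delta_\oplus(u,x^A.v,y^B.w)$; $!t\boxplus !u\to !(t\boxplus u)$; $(\Lambda X.t)\boxplus(\Lambda X.u)\to\Lambda X.(t\boxplus u)$; $a\bullet b.\star\to(a\times b).\star$; $a\bullet\lambda x^A.t\to\lambda x^A.a\bullet t$; $\delta_\otimes(a\bullet t,x^Ay^B.v)\to a\bullet\delta_\otimes(t,x^Ay^B.v)$; $a\bullet\langle\rangle\to\langle\rangle$; $a\bullet\langle t,u\rangle\to\langle a\bullet t,a\bullet u\rangle$; $\delta_\oplus(a\bullet t,x^A.v,y^B.w)\to a\bullet\delta_\oplus(t,x^A.v,y^B.w)$; $a\bullet !t\to !(a\bullet t)$; $a\bullet\Lambda X.t\to\Lambda X.a\bullet t$. -}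

module Defs where

-- The L^S_2 calculus, in locally nameless-free de Bruijn form.
-- * Proposition variables X are de Bruijn indices (binder: ∀).
-- * Proof-term variables come in two namespaces: linear ones  lv i
--   (bound by λ, δ⊗, δ&, δ⊕; declared in Γ) and non-linear ones  uv i
--   (bound by δ!; declared in Ξ).  In the paper each binder binds into
--   exactly one of Γ / Ξ, so this split is a faithful rendering.
-- * Terms/propositions modulo α-equivalence = de Bruijn syntax.

open import Level using (Level; _⊔_)
open import Data.Nat using (ℕ; zero; suc)
open import Data.List using (List; []; _∷_; map)
open import Data.List.Relation.Unary.All using (All)
open import Data.Maybe using (Maybe; just; nothing)
import Data.Maybe as Maybe
open import Relation.Binary.PropositionalEquality using (_≡_)
open import Algebra.Bundles using (Semiring)

infixr 7 _⊸_
infixr 8 _⊕_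
infixr 9 _&_
infixr 10 _⊗_
infix 11 !_

data Ty : Set where
  var  : ℕ → Ty
  𝟏    : Ty
  _⊸_  : Ty → Ty → Ty
  _⊗_  : Ty → Ty → Ty
  ⊤    : Ty
  𝟎    : Ty
  _&_  : Ty → Ty → Ty
  _⊕_  : Ty → Ty → Ty
  !_   : Ty → Ty
  ∀'   : Ty → Ty      -- ∀X.A, X is index 0 in A

ext : (ℕ → ℕ) → ℕ → ℕ
ext ρ zero    = zero
ext ρ (suc n) = suc (ρ n)

renT : (ℕ → ℕ) → Ty → Ty
renT ρ (var n) = var (ρ n)
renT ρ 𝟏 = 𝟏
renT ρ (A ⊸ B) = renT ρ A ⊸ renT ρ B
renT ρ (A ⊗ B) = renT ρ A ⊗ renT ρ B
renT ρ ⊤ = ⊤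
renT ρ 𝟎 = 𝟎
renT ρ (A & B) = renT ρ A & renT ρ B
renT ρ (A ⊕ B) = renT ρ A ⊕ renT ρ B
renT ρ (! A) = ! renT ρ A
renT ρ (∀' A) = ∀' (renT (ext ρ) A)

extsT : (ℕ → Ty) → ℕ → Ty
extsT σ zero    = var zero
extsT σ (suc n) = renT suc (σ n)

subT : (ℕ → Ty) → Ty → Ty
subT σ (var n) = σ n
subT σ 𝟏 = 𝟏
subT σ (A ⊸ B) = subT σ A ⊸ subT σ B
subT σ (A ⊗ B) = subT σ A ⊗ subT σ B
subT σ ⊤ = ⊤
subT σ 𝟎 = 𝟎
subT σ (A & B) = subT σ A & subT σ B
subT σ (A ⊕ B) = subT σ A ⊕ subT σ B
subT σ (! A) = ! subT σ A
subT σ (∀' A) = ∀' (subT (extsT σ) A)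

consT : Ty → ℕ → Ty
consT A zero    = A
consT A (suc n) = var n

_[_]T : Ty → Ty → Ty
B [ A ]T = subT (consT A) B

-- Contexts
-- Ξ : non-linear context (list of types, indexed by uv).
-- Γ : linear context, a list of slots indexed by lv; a slot is either
--     'just A' (the declaration belongs to this sequent's Γ) or 'nothing'
--     (the variable is not declared in this sequent).  The paper's set Γ
--     is the set of 'just' slots; splitting Γ,Δ is pointwise.

UCtx : Set
UCtx = List Ty

LCtx : Set
LCtx = List (Maybe Ty)

Empty : LCtx → Set
Empty Γ = All (_≡ nothing) Γ

infix 4 _≔_⋈_
data _≔_⋈_ : LCtx → LCtx → LCtx → Set where
  done : [] ≔ [] ⋈ []
  left  : ∀ {A Γ Γ₁ Γ₂} → Γ ≔ Γ₁ ⋈ Γ₂ → (just A ∷ Γ) ≔ (just A ∷ Γ₁) ⋈ (nothing ∷ Γ₂)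
  right : ∀ {A Γ Γ₁ Γ₂} → Γ ≔ Γ₁ ⋈ Γ₂ → (just A ∷ Γ) ≔ (nothing ∷ Γ₁) ⋈ (just A ∷ Γ₂)
  skip  : ∀ {Γ Γ₁ Γ₂} → Γ ≔ Γ₁ ⋈ Γ₂ → (nothing ∷ Γ) ≔ (nothing ∷ Γ₁) ⋈ (nothing ∷ Γ₂)

data LOnly : LCtx → ℕ → Ty → Set where
  here  : ∀ {A Γ} → Empty Γ → LOnly (just A ∷ Γ) zero A
  there : ∀ {A Γ i} → LOnly Γ i A → LOnly (nothing ∷ Γ) (suc i) A

data UVar : UCtx → ℕ → Ty → Set where
  here  : ∀ {A Ξ} → UVar (A ∷ Ξ) zero A
  there : ∀ {A B Ξ i} → UVar Ξ i A → UVar (B ∷ Ξ) (suc i) A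

-- shifting all free proposition variables of a context (used for the
-- side condition X ∉ FV(Ξ,Γ) of the ∀-introduction rule)
↑Ξ : UCtx → UCtx
↑Ξ Ξ = map (renT suc) Ξ

↑Γ : LCtx → LCtx
↑Γ Γ = map (Maybe.map (renT suc)) Γ

module Calculus {c ℓ} (S : Semiring c ℓ) where
  open Semiring S using (Carrier; _+_; _*_)

  infixl 6 _⊞_
  infixl 9 _$_
  infixl 9 _·T_
  infixr 8 _•_
  infixr 7 _⊗ₜ_
  data Tm : Set c where
    lv     : ℕ → Tm
    uv     : ℕ → Tm
    _⊞_    : Tm → Tm → Tm
    _•_    : Carrier → Tm → Tm
    _·⋆    : Carrier → Tm
    δ𝟏     : Tm → Tm → Tm
    ƛ      : Ty → Tm → Tm                 -- λx^A.t   (binds lv 0)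
    _$_    : Tm → Tm → Tm
    _⊗ₜ_   : Tm → Tm → Tm
    δ⊗     : Tm → Ty → Ty → Tm → Tm       -- δ⊗(t, x^A y^B. u): y = lv 0, x = lv 1
    ⟨⟩     : Tm
    δ𝟎     : Tm → Tm
    ⟨_,_⟩  : Tm → Tm → Tm
    δ&₁    : Tm → Ty → Tm → Tm            -- δ¹&(t, x^A. u)  (binds lv 0)
    δ&₂    : Tm → Ty → Tm → Tm            -- δ²&(t, x^B. u)  (binds lv 0)
    inl    : Tm → Tm
    inr    : Tm → Tm
    δ⊕     : Tm → Ty → Tm → Ty → Tm → Tm  -- δ⊕(t, x^A.u, y^B.v) (each binds lv 0)
    !ₜ     : Tm → Tm
    δ!     : Tm → Ty → Tm → Tm            -- δ!(t, x^A. u)  (binds uv 0)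
    Λ      : Tm → Tm                      -- ΛX.t  (binds proposition var 0)
    _·T_   : Tm → Ty → Tm

  -- generic syntax traversal: an environment e tells what to do with
  -- linear variables, non-linear variables and propositions, and how to
  -- go under a linear binder, a non-linear binder, or a Λ.
  record Kit {e} (E : Set e) : Set (c ⊔ e) where
    field
      onL onU : E → ℕ → Tm
      onT     : E → Ty → Ty
      upL upU upT : E → E

  trav : ∀ {e} {E : Set e} → Kit E → E → Tm → Tm
  trav K s (lv i) = Kit.onL K s i
  trav K s (uv i) = Kit.onU K s i
  trav K s (t ⊞ u) = trav K s t ⊞ trav K s u
  trav K s (a • t) = a • trav K s t
  trav K s (a ·⋆) = a ·⋆
  trav K s (δ𝟏 t u) = δ𝟏 (trav K s t) (trav K s u)
  trav K s (ƛ A t) = ƛ (Kit.onT K s A) (trav K (Kit.upL K s) t)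
  trav K s (t $ u) = trav K s t $ trav K s u
  trav K s (t ⊗ₜ u) = trav K s t ⊗ₜ trav K s u
  trav K s (δ⊗ t A B u) =
    δ⊗ (trav K s t) (Kit.onT K s A) (Kit.onT K s B)
       (trav K (Kit.upL K (Kit.upL K s)) u)
  trav K s ⟨⟩ = ⟨⟩
  trav K s (δ𝟎 t) = δ𝟎 (trav K s t)
  trav K s ⟨ t , u ⟩ = ⟨ trav K s t , trav K s u ⟩
  trav K s (δ&₁ t A u) = δ&₁ (trav K s t) (Kit.onT K s A) (trav K (Kit.upL K s) u)
  trav K s (δ&₂ t A u) = δ&₂ (trav K s t) (Kit.onT K s A) (trav K (Kit.upL K s) u)
  trav K s (inl t) = inl (trav K s t)
  trav K s (inr t) = inr (trav K s t)
  trav K s (δ⊕ t A u B v) =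
    δ⊕ (trav K s t) (Kit.onT K s A) (trav K (Kit.upL K s) u)
                    (Kit.onT K s B) (trav K (Kit.upL K s) v)
  trav K s (!ₜ t) = !ₜ (trav K s t)
  trav K s (δ! t A u) = δ! (trav K s t) (Kit.onT K s A) (trav K (Kit.upU K s) u)
  trav K s (Λ t) = Λ (trav K (Kit.upT K s) t)
  trav K s (t ·T A) = trav K s t ·T Kit.onT K s A

  renL : (ℕ → ℕ) → Tm → Tm
  renL = trav record { onL = λ ρ i → lv (ρ i) ; onU = λ _ i → uv i
                     ; onT = λ _ A → A
                     ; upL = ext ; upU = λ ρ → ρ ; upT = λ ρ → ρ }

  renU : (ℕ → ℕ) → Tm → Tm
  renU = trav record { onL = λ _ i → lv i ; onU = λ ρ i → uv (ρ i)
                     ; onT = λ _ A → A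
                     ; upL = λ ρ → ρ ; upU = ext ; upT = λ ρ → ρ }

  renTm : (ℕ → ℕ) → Tm → Tm
  renTm = trav record { onL = λ _ i → lv i ; onU = λ _ i → uv i
                      ; onT = renT
                      ; upL = λ ρ → ρ ; upU = λ ρ → ρ ; upT = ext }

  extsL : (ℕ → Tm) → ℕ → Tm
  extsL σ zero    = lv zero
  extsL σ (suc n) = renL suc (σ n)

  extsU : (ℕ → Tm) → ℕ → Tm
  extsU σ zero    = uv zero
  extsU σ (suc n) = renU suc (σ n)

  subL : (ℕ → Tm) → Tm → Tm
  subL = trav record { onL = λ σ i → σ i ; onU = λ _ i → uv i
                     ; onT = λ _ A → A
                     ; upL = extsL
                     ; upU = λ σ i → renU suc (σ i)
                     ; upT = λ σ i → renTm suc (σ i) }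

  subU : (ℕ → Tm) → Tm → Tm
  subU = trav record { onL = λ _ i → lv i ; onU = λ σ i → σ i
                     ; onT = λ _ A → A
                     ; upL = λ σ i → renL suc (σ i)
                     ; upU = extsU
                     ; upT = λ σ i → renTm suc (σ i) }

  subTm : (ℕ → Ty) → Tm → Tm
  subTm = trav record { onL = λ _ i → lv i ; onU = λ _ i → uv i
                      ; onT = subT
                      ; upL = λ σ → σ ; upU = λ σ → σ ; upT = extsT }

  consL : Tm → ℕ → Tm
  consL u zero    = u
  consL u (suc n) = lv n

  cons2L : Tm → Tm → ℕ → Tm          -- (u/x, v/y) with x = lv 1, y = lv 0
  cons2L u v zero          = v
  cons2L u v (suc zero)    = u
  cons2L u v (suc (suc n)) = lv n

  consU : Tm → ℕ → Tm
  consU u zero    = u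
  consU u (suc n) = uv n

  _[_]L : Tm → Tm → Tm
  t [ u ]L = subL (consL u) t

  _[_]U : Tm → Tm → Tm
  t [ u ]U = subU (consU u) t

  _[_]Tm : Tm → Ty → Tm
  t [ A ]Tm = subTm (consT A) t

  infix 3 _︔_⊢_∶_
  data _︔_⊢_∶_ : UCtx → LCtx → Tm → Ty → Set c where
    ax     : ∀ {Ξ Γ i A} → LOnly Γ i A → Ξ ︔ Γ ⊢ lv i ∶ A
    ax!    : ∀ {Ξ Γ i A} → UVar Ξ i A → Empty Γ → Ξ ︔ Γ ⊢ uv i ∶ A
    sum    : ∀ {Ξ Γ t u A} → Ξ ︔ Γ ⊢ t ∶ A → Ξ ︔ Γ ⊢ u ∶ A → Ξ ︔ Γ ⊢ t ⊞ u ∶ A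
    prod   : ∀ {Ξ Γ t A} (a : Carrier) → Ξ ︔ Γ ⊢ t ∶ A → Ξ ︔ Γ ⊢ a • t ∶ A
    𝟏i     : ∀ {Ξ Γ} (a : Carrier) → Empty Γ → Ξ ︔ Γ ⊢ a ·⋆ ∶ 𝟏
    𝟏e     : ∀ {Ξ Γ Γ₁ Γ₂ t u A} → Γ ≔ Γ₁ ⋈ Γ₂ →
             Ξ ︔ Γ₁ ⊢ t ∶ 𝟏 → Ξ ︔ Γ₂ ⊢ u ∶ A → Ξ ︔ Γ ⊢ δ𝟏 t u ∶ A
    ⊸i     : ∀ {Ξ Γ t A B} → Ξ ︔ just A ∷ Γ ⊢ t ∶ B → Ξ ︔ Γ ⊢ ƛ A t ∶ A ⊸ B
    ⊸e     : ∀ {Ξ Γ Γ₁ Γ₂ t u A B} → Γ ≔ Γ₁ ⋈ Γ₂ →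
             Ξ ︔ Γ₁ ⊢ t ∶ A ⊸ B → Ξ ︔ Γ₂ ⊢ u ∶ A → Ξ ︔ Γ ⊢ t $ u ∶ B
    ⊗i     : ∀ {Ξ Γ Γ₁ Γ₂ t u A B} → Γ ≔ Γ₁ ⋈ Γ₂ →
             Ξ ︔ Γ₁ ⊢ t ∶ A → Ξ ︔ Γ₂ ⊢ u ∶ B → Ξ ︔ Γ ⊢ t ⊗ₜ u ∶ A ⊗ B
    ⊗e     : ∀ {Ξ Γ Γ₁ Γ₂ t u A B C} → Γ ≔ Γ₁ ⋈ Γ₂ →
             Ξ ︔ Γ₁ ⊢ t ∶ A ⊗ B → Ξ ︔ just B ∷ just A ∷ Γ₂ ⊢ u ∶ C →
             Ξ ︔ Γ ⊢ δ⊗ t A B u ∶ C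
    ⊤i     : ∀ {Ξ Γ} → Ξ ︔ Γ ⊢ ⟨⟩ ∶ ⊤
    𝟎e     : ∀ {Ξ Γ Γ₁ Γ₂ t C} → Γ ≔ Γ₁ ⋈ Γ₂ →
             Ξ ︔ Γ₁ ⊢ t ∶ 𝟎 → Ξ ︔ Γ ⊢ δ𝟎 t ∶ C
    &i     : ∀ {Ξ Γ t u A B} → Ξ ︔ Γ ⊢ t ∶ A → Ξ ︔ Γ ⊢ u ∶ B → Ξ ︔ Γ ⊢ ⟨ t , u ⟩ ∶ A & B
    &e₁    : ∀ {Ξ Γ Γ₁ Γ₂ t u A B C} → Γ ≔ Γ₁ ⋈ Γ₂ →
             Ξ ︔ Γ₁ ⊢ t ∶ A & B → Ξ ︔ just A ∷ Γ₂ ⊢ u ∶ C → Ξ ︔ Γ ⊢ δ&₁ t A u ∶ C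
    &e₂    : ∀ {Ξ Γ Γ₁ Γ₂ t u A B C} → Γ ≔ Γ₁ ⋈ Γ₂ →
             Ξ ︔ Γ₁ ⊢ t ∶ A & B → Ξ ︔ just B ∷ Γ₂ ⊢ u ∶ C → Ξ ︔ Γ ⊢ δ&₂ t B u ∶ C
    ⊕i₁    : ∀ {Ξ Γ t A B} → Ξ ︔ Γ ⊢ t ∶ A → Ξ ︔ Γ ⊢ inl t ∶ A ⊕ B
    ⊕i₂    : ∀ {Ξ Γ t A B} → Ξ ︔ Γ ⊢ t ∶ B → Ξ ︔ Γ ⊢ inr t ∶ A ⊕ B
    ⊕e     : ∀ {Ξ Γ Γ₁ Γ₂ t u v A B C} → Γ ≔ Γ₁ ⋈ Γ₂ →
             Ξ ︔ Γ₁ ⊢ t ∶ A ⊕ B → Ξ ︔ just A ∷ Γ₂ ⊢ u ∶ C → Ξ ︔ just B ∷ Γ₂ ⊢ v ∶ C →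
             Ξ ︔ Γ ⊢ δ⊕ t A u B v ∶ C
    !i     : ∀ {Ξ Γ t A} → Empty Γ → Ξ ︔ Γ ⊢ t ∶ A → Ξ ︔ Γ ⊢ !ₜ t ∶ ! A
    !e     : ∀ {Ξ Γ Γ₁ Γ₂ t u A B} → Γ ≔ Γ₁ ⋈ Γ₂ →
             Ξ ︔ Γ₁ ⊢ t ∶ ! A → (A ∷ Ξ) ︔ Γ₂ ⊢ u ∶ B → Ξ ︔ Γ ⊢ δ! t A u ∶ B
    ∀i     : ∀ {Ξ Γ t A} → ↑Ξ Ξ ︔ ↑Γ Γ ⊢ t ∶ A → Ξ ︔ Γ ⊢ Λ t ∶ ∀' A
    ∀e     : ∀ {Ξ Γ t B} (A : Ty) → Ξ ︔ Γ ⊢ t ∶ ∀' B → Ξ ︔ Γ ⊢ t ·T A ∶ B [ A ]T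

  infix 4 _⟶_
  data _⟶_ : Tm → Tm → Set c where
    β𝟏   : ∀ {a t} → δ𝟏 (a ·⋆) t ⟶ a • t
    β⊸   : ∀ {A t u} → ƛ A t $ u ⟶ t [ u ]L
    β⊗   : ∀ {u v A B w} → δ⊗ (u ⊗ₜ v) A B w ⟶ subL (cons2L u v) w
    β&₁  : ∀ {t₁ t₂ A v} → δ&₁ ⟨ t₁ , t₂ ⟩ A v ⟶ v [ t₁ ]L
    β&₂  : ∀ {t₁ t₂ A v} → δ&₂ ⟨ t₁ , t₂ ⟩ A v ⟶ v [ t₂ ]L
    β⊕₁  : ∀ {t A v B w} → δ⊕ (inl t) A v B w ⟶ v [ t ]L
    β⊕₂  : ∀ {u A v B w} → δ⊕ (inr u) A v B w ⟶ w [ u ]L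
    β!   : ∀ {t A u} → δ! (!ₜ t) A u ⟶ u [ t ]U
    β∀   : ∀ {t A} → Λ t ·T A ⟶ t [ A ]Tm
    ⊞⋆   : ∀ {a b} → (a ·⋆) ⊞ (b ·⋆) ⟶ (a + b) ·⋆
    ⊞ƛ   : ∀ {A t u} → ƛ A t ⊞ ƛ A u ⟶ ƛ A (t ⊞ u)
    ⊞δ⊗  : ∀ {t u A B v} → δ⊗ (t ⊞ u) A B v ⟶ δ⊗ t A B v ⊞ δ⊗ u A B v
    ⊞⟨⟩  : ⟨⟩ ⊞ ⟨⟩ ⟶ ⟨⟩
    ⊞⟨,⟩ : ∀ {t u v w} → ⟨ t , u ⟩ ⊞ ⟨ v , w ⟩ ⟶ ⟨ t ⊞ v , u ⊞ w ⟩
    ⊞δ⊕  : ∀ {t u A v B w} → δ⊕ (t ⊞ u) A v B w ⟶ δ⊕ t A v B w ⊞ δ⊕ u A v B w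
    ⊞!   : ∀ {t u} → !ₜ t ⊞ !ₜ u ⟶ !ₜ (t ⊞ u)
    ⊞Λ   : ∀ {t u} → Λ t ⊞ Λ u ⟶ Λ (t ⊞ u)
    •⋆   : ∀ {a b} → a • (b ·⋆) ⟶ (a * b) ·⋆
    •ƛ   : ∀ {a A t} → a • ƛ A t ⟶ ƛ A (a • t)
    •δ⊗  : ∀ {a t A B v} → δ⊗ (a • t) A B v ⟶ a • δ⊗ t A B v
    •⟨⟩  : ∀ {a} → a • ⟨⟩ ⟶ ⟨⟩
    •⟨,⟩ : ∀ {a t u} → a • ⟨ t , u ⟩ ⟶ ⟨ a • t , a • u ⟩
    •δ⊕  : ∀ {a t A v B w} → δ⊕ (a • t) A v B w ⟶ a • δ⊕ t A v B w
    •!   : ∀ {a t} → a • !ₜ t ⟶ !ₜ (a • t)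
    •Λ   : ∀ {a t} → a • Λ t ⟶ Λ (a • t)
    ⊞₁   : ∀ {t t' u} → t ⟶ t' → t ⊞ u ⟶ t' ⊞ u
    ⊞₂   : ∀ {t u u'} → u ⟶ u' → t ⊞ u ⟶ t ⊞ u'
    •c   : ∀ {a t t'} → t ⟶ t' → a • t ⟶ a • t'
    δ𝟏₁  : ∀ {t t' u} → t ⟶ t' → δ𝟏 t u ⟶ δ𝟏 t' u
    δ𝟏₂  : ∀ {t u u'} → u ⟶ u' → δ𝟏 t u ⟶ δ𝟏 t u'
    ƛc   : ∀ {A t t'} → t ⟶ t' → ƛ A t ⟶ ƛ A t'
    $₁   : ∀ {t t' u} → t ⟶ t' → t $ u ⟶ t' $ u
    $₂   : ∀ {t u u'} → u ⟶ u' → t $ u ⟶ t $ u'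
    ⊗₁   : ∀ {t t' u} → t ⟶ t' → t ⊗ₜ u ⟶ t' ⊗ₜ u
    ⊗₂   : ∀ {t u u'} → u ⟶ u' → t ⊗ₜ u ⟶ t ⊗ₜ u'
    δ⊗₁  : ∀ {t t' A B u} → t ⟶ t' → δ⊗ t A B u ⟶ δ⊗ t' A B u
    δ⊗₂  : ∀ {t A B u u'} → u ⟶ u' → δ⊗ t A B u ⟶ δ⊗ t A B u'
    δ𝟎c  : ∀ {t t'} → t ⟶ t' → δ𝟎 t ⟶ δ𝟎 t'
    ⟨,⟩₁ : ∀ {t t' u} → t ⟶ t' → ⟨ t , u ⟩ ⟶ ⟨ t' , u ⟩
    ⟨,⟩₂ : ∀ {t u u'} → u ⟶ u' → ⟨ t , u ⟩ ⟶ ⟨ t , u' ⟩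
    δ&₁₁ : ∀ {t t' A u} → t ⟶ t' → δ&₁ t A u ⟶ δ&₁ t' A u
    δ&₁₂ : ∀ {t A u u'} → u ⟶ u' → δ&₁ t A u ⟶ δ&₁ t A u'
    δ&₂₁ : ∀ {t t' A u} → t ⟶ t' → δ&₂ t A u ⟶ δ&₂ t' A u
    δ&₂₂ : ∀ {t A u u'} → u ⟶ u' → δ&₂ t A u ⟶ δ&₂ t A u'
    inlc : ∀ {t t'} → t ⟶ t' → inl t ⟶ inl t'
    inrc : ∀ {t t'} → t ⟶ t' → inr t ⟶ inr t'
    δ⊕₁  : ∀ {t t' A u B v} → t ⟶ t' → δ⊕ t A u B v ⟶ δ⊕ t' A u B v
    δ⊕₂  : ∀ {t A u u' B v} → u ⟶ u' → δ⊕ t A u B v ⟶ δ⊕ t A u' B v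
    δ⊕₃  : ∀ {t A u B v v'} → v ⟶ v' → δ⊕ t A u B v ⟶ δ⊕ t A u B v'
    !c   : ∀ {t t'} → t ⟶ t' → !ₜ t ⟶ !ₜ t'
    δ!₁  : ∀ {t t' A u} → t ⟶ t' → δ! t A u ⟶ δ! t' A u
    δ!₂  : ∀ {t A u u'} → u ⟶ u' → δ! t A u ⟶ δ! t A u'
    Λc   : ∀ {t t'} → t ⟶ t' → Λ t ⟶ Λ t'
    ·T₁  : ∀ {t t' A} → t ⟶ t' → t ·T A ⟶ t' ·T A

module Submission where

-- The β-rules reduce to substitution
-- lemmas for linear, non-linear and proposition variables. Under a linear
-- substitution the contexts of the substituted terms must partition the target
-- context along the splittings of the source one; a non-linear variable is only
-- ever replaced by a term typed without linear resources, so it may be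
-- duplicated or discarded. The rules for ⊞ and • are preserved because sums and
-- scalar products are typed in the same context as their arguments.

open import Defs
open import Level using (Level)
open import Algebra.Bundles using (Semiring)
open import Function using (_∘_)
open import Data.Nat using (ℕ; zero; suc)
open import Data.List using ([]; _∷_; map; length; replicate)
open import Data.List.Properties using (map-∘; map-cong; map-id; length-map; map-replicate)
open import Data.List.Relation.Unary.All using ([]; _∷_)
import Data.List.Relation.Unary.All as All
open import Data.List.Relation.Unary.All.Properties using (map⁺; replicate⁺)
open import Data.Maybe using (just; nothing)
import Data.Maybe as Maybe
import Data.Maybe.Properties as Maybe
open import Data.Product using (∃; ∃₂; _×_; _,_)
open import Relation.Binary.PropositionalEquality

-- Renaming and substitution of proposition variables

ext-cong : ∀ {ρ ρ'} → ρ ≗ ρ' → ext ρ ≗ ext ρ'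
ext-cong eq zero    = refl
ext-cong eq (suc n) = cong suc (eq n)

renT-cong : ∀ {ρ ρ'} → ρ ≗ ρ' → renT ρ ≗ renT ρ'
renT-cong eq (var n) = cong var (eq n)
renT-cong eq 𝟏       = refl
renT-cong eq (A ⊸ B) = cong₂ _⊸_ (renT-cong eq A) (renT-cong eq B)
renT-cong eq (A ⊗ B) = cong₂ _⊗_ (renT-cong eq A) (renT-cong eq B)
renT-cong eq ⊤       = refl
renT-cong eq 𝟎       = refl
renT-cong eq (A & B) = cong₂ _&_ (renT-cong eq A) (renT-cong eq B)
renT-cong eq (A ⊕ B) = cong₂ _⊕_ (renT-cong eq A) (renT-cong eq B)
renT-cong eq (! A)   = cong !_ (renT-cong eq A)
renT-cong eq (∀' A)  = cong ∀' (renT-cong (ext-cong eq) A)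

extsT-cong : ∀ {σ σ'} → σ ≗ σ' → extsT σ ≗ extsT σ'
extsT-cong eq zero    = refl
extsT-cong eq (suc n) = cong (renT suc) (eq n)

subT-cong : ∀ {σ σ'} → σ ≗ σ' → subT σ ≗ subT σ'
subT-cong eq (var n) = eq n
subT-cong eq 𝟏       = refl
subT-cong eq (A ⊸ B) = cong₂ _⊸_ (subT-cong eq A) (subT-cong eq B)
subT-cong eq (A ⊗ B) = cong₂ _⊗_ (subT-cong eq A) (subT-cong eq B)
subT-cong eq ⊤       = refl
subT-cong eq 𝟎       = refl
subT-cong eq (A & B) = cong₂ _&_ (subT-cong eq A) (subT-cong eq B)
subT-cong eq (A ⊕ B) = cong₂ _⊕_ (subT-cong eq A) (subT-cong eq B)
subT-cong eq (! A)   = cong !_ (subT-cong eq A)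
subT-cong eq (∀' A)  = cong ∀' (subT-cong (extsT-cong eq) A)

ext-∘ : ∀ ρ ρ' → ext ρ ∘ ext ρ' ≗ ext (ρ ∘ ρ')
ext-∘ ρ ρ' zero    = refl
ext-∘ ρ ρ' (suc n) = refl

renT-renT : ∀ ρ ρ' A → renT ρ (renT ρ' A) ≡ renT (ρ ∘ ρ') A
renT-renT ρ ρ' (var n) = refl
renT-renT ρ ρ' 𝟏       = refl
renT-renT ρ ρ' (A ⊸ B) = cong₂ _⊸_ (renT-renT ρ ρ' A) (renT-renT ρ ρ' B)
renT-renT ρ ρ' (A ⊗ B) = cong₂ _⊗_ (renT-renT ρ ρ' A) (renT-renT ρ ρ' B)
renT-renT ρ ρ' ⊤       = refl
renT-renT ρ ρ' 𝟎       = refl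
renT-renT ρ ρ' (A & B) = cong₂ _&_ (renT-renT ρ ρ' A) (renT-renT ρ ρ' B)
renT-renT ρ ρ' (A ⊕ B) = cong₂ _⊕_ (renT-renT ρ ρ' A) (renT-renT ρ ρ' B)
renT-renT ρ ρ' (! A)   = cong !_ (renT-renT ρ ρ' A)
renT-renT ρ ρ' (∀' A)  =
  cong ∀' (trans (renT-renT (ext ρ) (ext ρ') A) (renT-cong (ext-∘ ρ ρ') A))

extsT-ext : ∀ σ ρ → extsT σ ∘ ext ρ ≗ extsT (σ ∘ ρ)
extsT-ext σ ρ zero    = refl
extsT-ext σ ρ (suc n) = refl

subT-renT : ∀ σ ρ A → subT σ (renT ρ A) ≡ subT (σ ∘ ρ) A
subT-renT σ ρ (var n) = refl
subT-renT σ ρ 𝟏       = refl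
subT-renT σ ρ (A ⊸ B) = cong₂ _⊸_ (subT-renT σ ρ A) (subT-renT σ ρ B)
subT-renT σ ρ (A ⊗ B) = cong₂ _⊗_ (subT-renT σ ρ A) (subT-renT σ ρ B)
subT-renT σ ρ ⊤       = refl
subT-renT σ ρ 𝟎       = refl
subT-renT σ ρ (A & B) = cong₂ _&_ (subT-renT σ ρ A) (subT-renT σ ρ B)
subT-renT σ ρ (A ⊕ B) = cong₂ _⊕_ (subT-renT σ ρ A) (subT-renT σ ρ B)
subT-renT σ ρ (! A)   = cong !_ (subT-renT σ ρ A)
subT-renT σ ρ (∀' A)  =
  cong ∀' (trans (subT-renT (extsT σ) (ext ρ) A) (subT-cong (extsT-ext σ ρ) A))

renT-extsT : ∀ ρ σ → renT (ext ρ) ∘ extsT σ ≗ extsT (renT ρ ∘ σ)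
renT-extsT ρ σ zero    = refl
renT-extsT ρ σ (suc n) =
  trans (renT-renT (ext ρ) suc (σ n)) (sym (renT-renT suc ρ (σ n)))

renT-subT : ∀ ρ σ A → renT ρ (subT σ A) ≡ subT (renT ρ ∘ σ) A
renT-subT ρ σ (var n) = refl
renT-subT ρ σ 𝟏       = refl
renT-subT ρ σ (A ⊸ B) = cong₂ _⊸_ (renT-subT ρ σ A) (renT-subT ρ σ B)
renT-subT ρ σ (A ⊗ B) = cong₂ _⊗_ (renT-subT ρ σ A) (renT-subT ρ σ B)
renT-subT ρ σ ⊤       = refl
renT-subT ρ σ 𝟎       = refl
renT-subT ρ σ (A & B) = cong₂ _&_ (renT-subT ρ σ A) (renT-subT ρ σ B)
renT-subT ρ σ (A ⊕ B) = cong₂ _⊕_ (renT-subT ρ σ A) (renT-subT ρ σ B)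
renT-subT ρ σ (! A)   = cong !_ (renT-subT ρ σ A)
renT-subT ρ σ (∀' A)  =
  cong ∀' (trans (renT-subT (ext ρ) (extsT σ) A) (subT-cong (renT-extsT ρ σ) A))

subT-extsT : ∀ σ τ → subT (extsT σ) ∘ extsT τ ≗ extsT (subT σ ∘ τ)
subT-extsT σ τ zero    = refl
subT-extsT σ τ (suc n) =
  trans (subT-renT (extsT σ) suc (τ n)) (sym (renT-subT suc σ (τ n)))

subT-subT : ∀ σ τ A → subT σ (subT τ A) ≡ subT (subT σ ∘ τ) A
subT-subT σ τ (var n) = refl
subT-subT σ τ 𝟏       = refl
subT-subT σ τ (A ⊸ B) = cong₂ _⊸_ (subT-subT σ τ A) (subT-subT σ τ B)
subT-subT σ τ (A ⊗ B) = cong₂ _⊗_ (subT-subT σ τ A) (subT-subT σ τ B)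
subT-subT σ τ ⊤       = refl
subT-subT σ τ 𝟎       = refl
subT-subT σ τ (A & B) = cong₂ _&_ (subT-subT σ τ A) (subT-subT σ τ B)
subT-subT σ τ (A ⊕ B) = cong₂ _⊕_ (subT-subT σ τ A) (subT-subT σ τ B)
subT-subT σ τ (! A)   = cong !_ (subT-subT σ τ A)
subT-subT σ τ (∀' A)  =
  cong ∀' (trans (subT-subT (extsT σ) (extsT τ) A) (subT-cong (subT-extsT σ τ) A))

extsT-var : extsT var ≗ var
extsT-var zero    = refl
extsT-var (suc n) = refl

subT-var : ∀ A → subT var A ≡ A
subT-var (var n) = refl
subT-var 𝟏       = refl
subT-var (A ⊸ B) = cong₂ _⊸_ (subT-var A) (subT-var B)
subT-var (A ⊗ B) = cong₂ _⊗_ (subT-var A) (subT-var B)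
subT-var ⊤       = refl
subT-var 𝟎       = refl
subT-var (A & B) = cong₂ _&_ (subT-var A) (subT-var B)
subT-var (A ⊕ B) = cong₂ _⊕_ (subT-var A) (subT-var B)
subT-var (! A)   = cong !_ (subT-var A)
subT-var (∀' A)  = cong ∀' (trans (subT-cong extsT-var A) (subT-var A))

ext-extsT : ∀ {ρ σ} → var ∘ ρ ≗ σ → var ∘ ext ρ ≗ extsT σ
ext-extsT eq zero    = refl
ext-extsT eq (suc n) = cong (renT suc) (eq n)

renT-as-subT : ∀ {ρ σ} → var ∘ ρ ≗ σ → renT ρ ≗ subT σ
renT-as-subT eq (var n) = eq n
renT-as-subT eq 𝟏       = refl
renT-as-subT eq (A ⊸ B) = cong₂ _⊸_ (renT-as-subT eq A) (renT-as-subT eq B)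
renT-as-subT eq (A ⊗ B) = cong₂ _⊗_ (renT-as-subT eq A) (renT-as-subT eq B)
renT-as-subT eq ⊤       = refl
renT-as-subT eq 𝟎       = refl
renT-as-subT eq (A & B) = cong₂ _&_ (renT-as-subT eq A) (renT-as-subT eq B)
renT-as-subT eq (A ⊕ B) = cong₂ _⊕_ (renT-as-subT eq A) (renT-as-subT eq B)
renT-as-subT eq (! A)   = cong !_ (renT-as-subT eq A)
renT-as-subT eq (∀' A)  = cong ∀' (renT-as-subT (ext-extsT eq) A)

subT-extsT-renT-suc : ∀ σ A → subT (extsT σ) (renT suc A) ≡ renT suc (subT σ A)
subT-extsT-renT-suc σ A = trans (subT-renT (extsT σ) suc A) (sym (renT-subT suc σ A))

renT-suc-[]T : ∀ A B → renT suc A [ B ]T ≡ A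
renT-suc-[]T A B = trans (subT-renT (consT B) suc A) (subT-var A)

subT-[]T : ∀ σ A B → subT σ (B [ A ]T) ≡ subT (extsT σ) B [ subT σ A ]T
subT-[]T σ A B = begin
  subT σ (subT (consT A) B)                   ≡⟨ subT-subT σ (consT A) B ⟩
  subT (subT σ ∘ consT A) B                   ≡⟨ subT-cong consT-extsT B ⟩
  subT (subT (consT (subT σ A)) ∘ extsT σ) B  ≡⟨ subT-subT (consT (subT σ A)) (extsT σ) B ⟨
  subT (consT (subT σ A)) (subT (extsT σ) B)  ∎
  where
  open ≡-Reasoning
  consT-extsT : subT σ ∘ consT A ≗ subT (consT (subT σ A)) ∘ extsT σ
  consT-extsT zero    = refl
  consT-extsT (suc n) = sym (renT-suc-[]T (σ n) (subT σ A))

mapΓ : (Ty → Ty) → LCtx → LCtx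
mapΓ f = map (Maybe.map f)

mapΓ-cong : ∀ {f g} → f ≗ g → mapΓ f ≗ mapΓ g
mapΓ-cong eq = map-cong (Maybe.map-cong eq)

mapΓ-∘ : ∀ {f g} → mapΓ (g ∘ f) ≗ mapΓ g ∘ mapΓ f
mapΓ-∘ Γ = trans (map-cong Maybe.map-∘ Γ) (map-∘ Γ)

mapΓ-id : mapΓ (λ A → A) ≗ (λ Γ → Γ)
mapΓ-id Γ = trans (map-cong Maybe.map-id Γ) (map-id Γ)

subT-↑Ξ : ∀ σ Ξ → map (subT (extsT σ)) (↑Ξ Ξ) ≡ ↑Ξ (map (subT σ) Ξ)
subT-↑Ξ σ Ξ = trans (sym (map-∘ Ξ)) (trans (map-cong (subT-extsT-renT-suc σ) Ξ) (map-∘ Ξ))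

subT-↑Γ : ∀ σ Γ → mapΓ (subT (extsT σ)) (↑Γ Γ) ≡ ↑Γ (mapΓ (subT σ) Γ)
subT-↑Γ σ Γ = trans (sym (mapΓ-∘ Γ)) (trans (mapΓ-cong (subT-extsT-renT-suc σ) Γ) (mapΓ-∘ Γ))

[]T-↑Ξ : ∀ A Ξ → map (_[ A ]T) (↑Ξ Ξ) ≡ Ξ
[]T-↑Ξ A Ξ = trans (sym (map-∘ Ξ)) (trans (map-cong (λ B → renT-suc-[]T B A) Ξ) (map-id Ξ))

[]T-↑Γ : ∀ A Γ → mapΓ (_[ A ]T) (↑Γ Γ) ≡ Γ
[]T-↑Γ A Γ = trans (sym (mapΓ-∘ Γ)) (trans (mapΓ-cong (λ B → renT-suc-[]T B A) Γ) (mapΓ-id Γ))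

∅ : ℕ → LCtx
∅ n = replicate n nothing

∅-Empty : ∀ n → Empty (∅ n)
∅-Empty n = replicate⁺ n refl

Empty⇒≡∅ : ∀ {Γ} → Empty Γ → Γ ≡ ∅ (length Γ)
Empty⇒≡∅ []         = refl
Empty⇒≡∅ (refl ∷ e) = cong (nothing ∷_) (Empty⇒≡∅ e)

Empty-mapΓ : ∀ {f Γ} → Empty Γ → Empty (mapΓ f Γ)
Empty-mapΓ e = map⁺ (All.map Maybe.map-nothing e)

LOnly-mapΓ : ∀ {f Γ i A} → LOnly Γ i A → LOnly (mapΓ f Γ) i (f A)
LOnly-mapΓ (here e)  = here (Empty-mapΓ e)
LOnly-mapΓ (there l) = there (LOnly-mapΓ l)

UVar-map : ∀ {f Ξ i A} → UVar Ξ i A → UVar (map f Ξ) i (f A)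
UVar-map here      = here
UVar-map (there x) = there (UVar-map x)

UVar-map⁻ : ∀ {f} Ξ {i B} → UVar (map f Ξ) i B → ∃ λ A → UVar Ξ i A × B ≡ f A
UVar-map⁻ (A ∷ Ξ) here = A , here , refl
UVar-map⁻ (A ∷ Ξ) (there x) with UVar-map⁻ Ξ x
... | B , y , eq = B , there y , eq

⋈-mapΓ : ∀ {f Γ Γ₁ Γ₂} → Γ ≔ Γ₁ ⋈ Γ₂ → mapΓ f Γ ≔ mapΓ f Γ₁ ⋈ mapΓ f Γ₂
⋈-mapΓ done      = done
⋈-mapΓ (left p)  = left (⋈-mapΓ p)
⋈-mapΓ (right p) = right (⋈-mapΓ p)
⋈-mapΓ (skip p)  = skip (⋈-mapΓ p)

⋈-comm : ∀ {Γ Γ₁ Γ₂} → Γ ≔ Γ₁ ⋈ Γ₂ → Γ ≔ Γ₂ ⋈ Γ₁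
⋈-comm done      = done
⋈-comm (left p)  = right (⋈-comm p)
⋈-comm (right p) = left (⋈-comm p)
⋈-comm (skip p)  = skip (⋈-comm p)

⋈-assoc : ∀ {Γ Γ₁ Γ₂ Γ₂₁ Γ₂₂} → Γ ≔ Γ₁ ⋈ Γ₂ → Γ₂ ≔ Γ₂₁ ⋈ Γ₂₂ →
          ∃ λ Γ₁₂ → Γ ≔ Γ₁₂ ⋈ Γ₂₂ × Γ₁₂ ≔ Γ₁ ⋈ Γ₂₁
⋈-assoc done done = [] , done , done
⋈-assoc (left p) (skip q) with ⋈-assoc p q
... | _ , r , s = _ , left r , left s
⋈-assoc (right p) (left q) with ⋈-assoc p q
... | _ , r , s = _ , left r , right s
⋈-assoc (right p) (right q) with ⋈-assoc p q
... | _ , r , s = _ , right r , skip s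
⋈-assoc (skip p) (skip q) with ⋈-assoc p q
... | _ , r , s = _ , skip r , skip s

⋈-emptyˡ : ∀ {Γ Γ₁ Γ₂} → Γ ≔ Γ₁ ⋈ Γ₂ → Empty Γ₁ → Γ ≡ Γ₂
⋈-emptyˡ done      []        = refl
⋈-emptyˡ (left p)  (() ∷ _)
⋈-emptyˡ (right p) (_ ∷ e)   = cong (just _ ∷_) (⋈-emptyˡ p e)
⋈-emptyˡ (skip p)  (_ ∷ e)   = cong (nothing ∷_) (⋈-emptyˡ p e)

⋈-emptyʳ : ∀ {Γ Γ₁ Γ₂} → Γ ≔ Γ₁ ⋈ Γ₂ → Empty Γ₂ → Γ ≡ Γ₁
⋈-emptyʳ p = ⋈-emptyˡ (⋈-comm p)

⋈-Empty : ∀ {Γ} → Empty Γ → Γ ≔ Γ ⋈ Γ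
⋈-Empty []         = done
⋈-Empty (refl ∷ e) = skip (⋈-Empty e)

⋈-identityˡ : ∀ Γ → Γ ≔ ∅ (length Γ) ⋈ Γ
⋈-identityˡ []            = done
⋈-identityˡ (nothing ∷ Γ) = skip (⋈-identityˡ Γ)
⋈-identityˡ (just A ∷ Γ)  = right (⋈-identityˡ Γ)

⋈-lengthˡ : ∀ {Γ Γ₁ Γ₂} → Γ ≔ Γ₁ ⋈ Γ₂ → length Γ₁ ≡ length Γ
⋈-lengthˡ done      = refl
⋈-lengthˡ (left p)  = cong suc (⋈-lengthˡ p)
⋈-lengthˡ (right p) = cong suc (⋈-lengthˡ p)
⋈-lengthˡ (skip p)  = cong suc (⋈-lengthˡ p)

⋈-lengthʳ : ∀ {Γ Γ₁ Γ₂} → Γ ≔ Γ₁ ⋈ Γ₂ → length Γ₂ ≡ length Γ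
⋈-lengthʳ p = ⋈-lengthˡ (⋈-comm p)

UVar-ext : ∀ {ρ : ℕ → ℕ} {Ξ Ξ' A} → (∀ {i B} → UVar Ξ i B → UVar Ξ' (ρ i) B) →
           ∀ {i B} → UVar (A ∷ Ξ) i B → UVar (A ∷ Ξ') (ext ρ i) B
UVar-ext h here      = here
UVar-ext h (there x) = there (h x)

UVar-↑Ξ : ∀ {ρ : ℕ → ℕ} Ξ {Ξ'} → (∀ {i B} → UVar Ξ i B → UVar Ξ' (ρ i) B) →
          ∀ {i B} → UVar (↑Ξ Ξ) i B → UVar (↑Ξ Ξ') (ρ i) B
UVar-↑Ξ Ξ h x with UVar-map⁻ Ξ x
... | _ , y , refl = UVar-map {renT suc} (h y)

data Wk : (ℕ → ℕ) → LCtx → LCtx → Set where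
  fresh : ∀ {Γ} → Wk suc Γ (nothing ∷ Γ)
  lift  : ∀ {ρ Γ Δ x} → Wk ρ Γ Δ → Wk (ext ρ) (x ∷ Γ) (x ∷ Δ)

Wk-Empty : ∀ {ρ Γ Δ} → Wk ρ Γ Δ → Empty Γ → Empty Δ
Wk-Empty fresh    e       = refl ∷ e
Wk-Empty (lift w) (p ∷ e) = p ∷ Wk-Empty w e

Wk-LOnly : ∀ {ρ Γ Δ i A} → Wk ρ Γ Δ → LOnly Γ i A → LOnly Δ (ρ i) A
Wk-LOnly fresh    l         = there l
Wk-LOnly (lift w) (here e)  = here (Wk-Empty w e)
Wk-LOnly (lift w) (there l) = there (Wk-LOnly w l)

Wk-⋈ : ∀ {ρ Γ Δ Γ₁ Γ₂} → Wk ρ Γ Δ → Γ ≔ Γ₁ ⋈ Γ₂ →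
       ∃₂ λ Δ₁ Δ₂ → Δ ≔ Δ₁ ⋈ Δ₂ × Wk ρ Γ₁ Δ₁ × Wk ρ Γ₂ Δ₂
Wk-⋈ fresh p = _ , _ , skip p , fresh , fresh
Wk-⋈ (lift w) (left p) with Wk-⋈ w p
... | _ , _ , q , w₁ , w₂ = _ , _ , left q , lift w₁ , lift w₂
Wk-⋈ (lift w) (right p) with Wk-⋈ w p
... | _ , _ , q , w₁ , w₂ = _ , _ , right q , lift w₁ , lift w₂
Wk-⋈ (lift w) (skip p) with Wk-⋈ w p
... | _ , _ , q , w₁ , w₂ = _ , _ , skip q , lift w₁ , lift w₂

Wk-↑Γ : ∀ {ρ Γ Δ} → Wk ρ Γ Δ → Wk ρ (↑Γ Γ) (↑Γ Δ)
Wk-↑Γ fresh    = fresh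
Wk-↑Γ (lift w) = lift (Wk-↑Γ w)

-- Typing is preserved by renaming and substitution

module SubjectReduction {c ℓ} (S : Semiring c ℓ) where
  open Calculus S

  ⊢-cast : ∀ {Ξ Ξ' Γ Γ' t t' A A'} → Ξ ≡ Ξ' → Γ ≡ Γ' → t ≡ t' → A ≡ A' →
           Ξ ︔ Γ ⊢ t ∶ A → Ξ' ︔ Γ' ⊢ t' ∶ A'
  ⊢-cast refl refl refl refl d = d

  ⊢-renL : ∀ {ρ Ξ Γ Δ t A} → Wk ρ Γ Δ → Ξ ︔ Γ ⊢ t ∶ A → Ξ ︔ Δ ⊢ renL ρ t ∶ A
  ⊢-renL w (ax l)       = ax (Wk-LOnly w l)
  ⊢-renL w (ax! x e)    = ax! x (Wk-Empty w e)
  ⊢-renL w (sum d e)    = sum (⊢-renL w d) (⊢-renL w e)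
  ⊢-renL w (prod a d)   = prod a (⊢-renL w d)
  ⊢-renL w (𝟏i a e)     = 𝟏i a (Wk-Empty w e)
  ⊢-renL w (𝟏e p d e) with Wk-⋈ w p
  ... | _ , _ , q , w₁ , w₂ = 𝟏e q (⊢-renL w₁ d) (⊢-renL w₂ e)
  ⊢-renL w (⊸i d)       = ⊸i (⊢-renL (lift w) d)
  ⊢-renL w (⊸e p d e) with Wk-⋈ w p
  ... | _ , _ , q , w₁ , w₂ = ⊸e q (⊢-renL w₁ d) (⊢-renL w₂ e)
  ⊢-renL w (⊗i p d e) with Wk-⋈ w p
  ... | _ , _ , q , w₁ , w₂ = ⊗i q (⊢-renL w₁ d) (⊢-renL w₂ e)
  ⊢-renL w (⊗e p d e) with Wk-⋈ w p
  ... | _ , _ , q , w₁ , w₂ = ⊗e q (⊢-renL w₁ d) (⊢-renL (lift (lift w₂)) e)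
  ⊢-renL w ⊤i           = ⊤i
  ⊢-renL w (𝟎e p d) with Wk-⋈ w p
  ... | _ , _ , q , w₁ , _ = 𝟎e q (⊢-renL w₁ d)
  ⊢-renL w (&i d e)     = &i (⊢-renL w d) (⊢-renL w e)
  ⊢-renL w (&e₁ p d e) with Wk-⋈ w p
  ... | _ , _ , q , w₁ , w₂ = &e₁ q (⊢-renL w₁ d) (⊢-renL (lift w₂) e)
  ⊢-renL w (&e₂ p d e) with Wk-⋈ w p
  ... | _ , _ , q , w₁ , w₂ = &e₂ q (⊢-renL w₁ d) (⊢-renL (lift w₂) e)
  ⊢-renL w (⊕i₁ d)      = ⊕i₁ (⊢-renL w d)
  ⊢-renL w (⊕i₂ d)      = ⊕i₂ (⊢-renL w d)
  ⊢-renL w (⊕e p d e f) with Wk-⋈ w p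
  ... | _ , _ , q , w₁ , w₂ = ⊕e q (⊢-renL w₁ d) (⊢-renL (lift w₂) e) (⊢-renL (lift w₂) f)
  ⊢-renL w (!i e d)     = !i (Wk-Empty w e) (⊢-renL w d)
  ⊢-renL w (!e p d e) with Wk-⋈ w p
  ... | _ , _ , q , w₁ , w₂ = !e q (⊢-renL w₁ d) (⊢-renL w₂ e)
  ⊢-renL w (∀i d)       = ∀i (⊢-renL (Wk-↑Γ w) d)
  ⊢-renL w (∀e A d)     = ∀e A (⊢-renL w d)

  ⊢-renU : ∀ {ρ Ξ Ξ' Γ t A} → (∀ {i B} → UVar Ξ i B → UVar Ξ' (ρ i) B) →
           Ξ ︔ Γ ⊢ t ∶ A → Ξ' ︔ Γ ⊢ renU ρ t ∶ A
  ⊢-renU h (ax l)       = ax l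
  ⊢-renU h (ax! x e)    = ax! (h x) e
  ⊢-renU h (sum d e)    = sum (⊢-renU h d) (⊢-renU h e)
  ⊢-renU h (prod a d)   = prod a (⊢-renU h d)
  ⊢-renU h (𝟏i a e)     = 𝟏i a e
  ⊢-renU h (𝟏e p d e)   = 𝟏e p (⊢-renU h d) (⊢-renU h e)
  ⊢-renU h (⊸i d)       = ⊸i (⊢-renU h d)
  ⊢-renU h (⊸e p d e)   = ⊸e p (⊢-renU h d) (⊢-renU h e)
  ⊢-renU h (⊗i p d e)   = ⊗i p (⊢-renU h d) (⊢-renU h e)
  ⊢-renU h (⊗e p d e)   = ⊗e p (⊢-renU h d) (⊢-renU h e)
  ⊢-renU h ⊤i           = ⊤i
  ⊢-renU h (𝟎e p d)     = 𝟎e p (⊢-renU h d)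
  ⊢-renU h (&i d e)     = &i (⊢-renU h d) (⊢-renU h e)
  ⊢-renU h (&e₁ p d e)  = &e₁ p (⊢-renU h d) (⊢-renU h e)
  ⊢-renU h (&e₂ p d e)  = &e₂ p (⊢-renU h d) (⊢-renU h e)
  ⊢-renU h (⊕i₁ d)      = ⊕i₁ (⊢-renU h d)
  ⊢-renU h (⊕i₂ d)      = ⊕i₂ (⊢-renU h d)
  ⊢-renU h (⊕e p d e f) = ⊕e p (⊢-renU h d) (⊢-renU h e) (⊢-renU h f)
  ⊢-renU h (!i e d)     = !i e (⊢-renU h d)
  ⊢-renU h (!e p d e)   = !e p (⊢-renU h d) (⊢-renU (UVar-ext h) e)
  ⊢-renU {Ξ = Ξ} h (∀i d) = ∀i (⊢-renU (UVar-↑Ξ Ξ h) d)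
  ⊢-renU h (∀e A d)     = ∀e A (⊢-renU h d)

  ⊢-subTm : ∀ σ {Ξ Γ t A} → Ξ ︔ Γ ⊢ t ∶ A →
            map (subT σ) Ξ ︔ mapΓ (subT σ) Γ ⊢ subTm σ t ∶ subT σ A
  ⊢-subTm σ (ax l)       = ax (LOnly-mapΓ l)
  ⊢-subTm σ (ax! x e)    = ax! (UVar-map x) (Empty-mapΓ e)
  ⊢-subTm σ (sum d e)    = sum (⊢-subTm σ d) (⊢-subTm σ e)
  ⊢-subTm σ (prod a d)   = prod a (⊢-subTm σ d)
  ⊢-subTm σ (𝟏i a e)     = 𝟏i a (Empty-mapΓ e)
  ⊢-subTm σ (𝟏e p d e)   = 𝟏e (⋈-mapΓ p) (⊢-subTm σ d) (⊢-subTm σ e)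
  ⊢-subTm σ (⊸i d)       = ⊸i (⊢-subTm σ d)
  ⊢-subTm σ (⊸e p d e)   = ⊸e (⋈-mapΓ p) (⊢-subTm σ d) (⊢-subTm σ e)
  ⊢-subTm σ (⊗i p d e)   = ⊗i (⋈-mapΓ p) (⊢-subTm σ d) (⊢-subTm σ e)
  ⊢-subTm σ (⊗e p d e)   = ⊗e (⋈-mapΓ p) (⊢-subTm σ d) (⊢-subTm σ e)
  ⊢-subTm σ ⊤i           = ⊤i
  ⊢-subTm σ (𝟎e p d)     = 𝟎e (⋈-mapΓ p) (⊢-subTm σ d)
  ⊢-subTm σ (&i d e)     = &i (⊢-subTm σ d) (⊢-subTm σ e)
  ⊢-subTm σ (&e₁ p d e)  = &e₁ (⋈-mapΓ p) (⊢-subTm σ d) (⊢-subTm σ e)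
  ⊢-subTm σ (&e₂ p d e)  = &e₂ (⋈-mapΓ p) (⊢-subTm σ d) (⊢-subTm σ e)
  ⊢-subTm σ (⊕i₁ d)      = ⊕i₁ (⊢-subTm σ d)
  ⊢-subTm σ (⊕i₂ d)      = ⊕i₂ (⊢-subTm σ d)
  ⊢-subTm σ (⊕e p d e f) = ⊕e (⋈-mapΓ p) (⊢-subTm σ d) (⊢-subTm σ e) (⊢-subTm σ f)
  ⊢-subTm σ (!i e d)     = !i (Empty-mapΓ e) (⊢-subTm σ d)
  ⊢-subTm σ (!e p d e)   = !e (⋈-mapΓ p) (⊢-subTm σ d) (⊢-subTm σ e)
  ⊢-subTm σ {Ξ} {Γ} (∀i d) =
    ∀i (⊢-cast (subT-↑Ξ σ Ξ) (subT-↑Γ σ Γ) refl refl (⊢-subTm (extsT σ) d))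
  ⊢-subTm σ (∀e {B = B} A d) =
    ⊢-cast refl refl refl (sym (subT-[]T σ A B)) (∀e (subT σ A) (⊢-subTm σ d))

  renTm-as-subTm : ∀ {ρ σ} → var ∘ ρ ≗ σ → renTm ρ ≗ subTm σ
  renTm-as-subTm eq (lv i)         = refl
  renTm-as-subTm eq (uv i)         = refl
  renTm-as-subTm eq (t ⊞ u)        = cong₂ _⊞_ (renTm-as-subTm eq t) (renTm-as-subTm eq u)
  renTm-as-subTm eq (a • t)        = cong (a •_) (renTm-as-subTm eq t)
  renTm-as-subTm eq (a ·⋆)         = refl
  renTm-as-subTm eq (δ𝟏 t u)       = cong₂ δ𝟏 (renTm-as-subTm eq t) (renTm-as-subTm eq u)
  renTm-as-subTm eq (ƛ A t)        = cong₂ ƛ (renT-as-subT eq A) (renTm-as-subTm eq t)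
  renTm-as-subTm eq (t $ u)        = cong₂ _$_ (renTm-as-subTm eq t) (renTm-as-subTm eq u)
  renTm-as-subTm eq (t ⊗ₜ u)       = cong₂ _⊗ₜ_ (renTm-as-subTm eq t) (renTm-as-subTm eq u)
  renTm-as-subTm eq (δ⊗ t A B u)
    rewrite renTm-as-subTm eq t | renT-as-subT eq A | renT-as-subT eq B
          | renTm-as-subTm eq u    = refl
  renTm-as-subTm eq ⟨⟩             = refl
  renTm-as-subTm eq (δ𝟎 t)         = cong δ𝟎 (renTm-as-subTm eq t)
  renTm-as-subTm eq ⟨ t , u ⟩      = cong₂ ⟨_,_⟩ (renTm-as-subTm eq t) (renTm-as-subTm eq u)
  renTm-as-subTm eq (δ&₁ t A u)
    rewrite renTm-as-subTm eq t | renT-as-subT eq A | renTm-as-subTm eq u = refl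
  renTm-as-subTm eq (δ&₂ t A u)
    rewrite renTm-as-subTm eq t | renT-as-subT eq A | renTm-as-subTm eq u = refl
  renTm-as-subTm eq (inl t)        = cong inl (renTm-as-subTm eq t)
  renTm-as-subTm eq (inr t)        = cong inr (renTm-as-subTm eq t)
  renTm-as-subTm eq (δ⊕ t A u B v)
    rewrite renTm-as-subTm eq t | renT-as-subT eq A | renTm-as-subTm eq u
          | renT-as-subT eq B | renTm-as-subTm eq v = refl
  renTm-as-subTm eq (!ₜ t)         = cong !ₜ (renTm-as-subTm eq t)
  renTm-as-subTm eq (δ! t A u)
    rewrite renTm-as-subTm eq t | renT-as-subT eq A | renTm-as-subTm eq u = refl
  renTm-as-subTm eq (Λ t)          = cong Λ (renTm-as-subTm (ext-extsT eq) t)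
  renTm-as-subTm eq (t ·T A)       = cong₂ _·T_ (renTm-as-subTm eq t) (renT-as-subT eq A)

  ⊢-renTm : ∀ ρ {Ξ Γ t A} → Ξ ︔ Γ ⊢ t ∶ A →
            map (renT ρ) Ξ ︔ mapΓ (renT ρ) Γ ⊢ renTm ρ t ∶ renT ρ A
  ⊢-renTm ρ {Ξ} {Γ} {t} {A} d =
    ⊢-cast (sym (map-cong (renT-as-subT same) Ξ)) (sym (mapΓ-cong (renT-as-subT same) Γ))
           (sym (renTm-as-subTm same t)) (sym (renT-as-subT same A)) (⊢-subTm (var ∘ ρ) d)
    where
    same : var ∘ ρ ≗ var ∘ ρ
    same n = refl

  -- σ sends the variables declared in Γ to terms whose contexts partition Δ
  data LSub (Ξ : UCtx) : (ℕ → Tm) → LCtx → LCtx → Set c where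
    []     : ∀ {σ Δ} → Empty Δ → LSub Ξ σ [] Δ
    unused : ∀ {σ Γ Δ} → LSub Ξ (σ ∘ suc) Γ Δ → LSub Ξ σ (nothing ∷ Γ) Δ
    used   : ∀ {σ Γ Δ Δ₁ Δ₂ A} → Δ ≔ Δ₁ ⋈ Δ₂ → Ξ ︔ Δ₁ ⊢ σ zero ∶ A →
             LSub Ξ (σ ∘ suc) Γ Δ₂ → LSub Ξ σ (just A ∷ Γ) Δ

  LSub-Empty : ∀ {Ξ σ Γ Δ} → LSub Ξ σ Γ Δ → Empty Γ → Empty Δ
  LSub-Empty ([] e)      _        = e
  LSub-Empty (unused s)  (_ ∷ e)  = LSub-Empty s e
  LSub-Empty (used _ _ _) (() ∷ _)

  LSub-LOnly : ∀ {Ξ σ Γ Δ i A} → LSub Ξ σ Γ Δ → LOnly Γ i A → Ξ ︔ Δ ⊢ σ i ∶ A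
  LSub-LOnly (used p d s) (here e) = ⊢-cast refl (sym (⋈-emptyʳ p (LSub-Empty s e))) refl refl d
  LSub-LOnly (unused s)   (there l) = LSub-LOnly s l

  LSub-⋈ : ∀ {Ξ σ Γ Δ Γ₁ Γ₂} → LSub Ξ σ Γ Δ → Γ ≔ Γ₁ ⋈ Γ₂ →
           ∃₂ λ Δ₁ Δ₂ → Δ ≔ Δ₁ ⋈ Δ₂ × LSub Ξ σ Γ₁ Δ₁ × LSub Ξ σ Γ₂ Δ₂
  LSub-⋈ ([] e) done = _ , _ , ⋈-Empty e , [] e , [] e
  LSub-⋈ (unused s) (skip p) with LSub-⋈ s p
  ... | _ , _ , q , s₁ , s₂ = _ , _ , q , unused s₁ , unused s₂
  LSub-⋈ (used r d s) (left p) with LSub-⋈ s p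
  ... | _ , _ , q , s₁ , s₂ with ⋈-assoc r q
  ... | _ , r' , q' = _ , _ , r' , used q' d s₁ , unused s₂
  LSub-⋈ (used r d s) (right p) with LSub-⋈ s p
  ... | _ , _ , q , s₁ , s₂ with ⋈-assoc r (⋈-comm q)
  ... | _ , r' , q' = _ , _ , ⋈-comm r' , unused s₁ , used q' d s₂

  LSub-weakenL : ∀ {Ξ σ Γ Δ} → LSub Ξ σ Γ Δ → LSub Ξ (renL suc ∘ σ) Γ (nothing ∷ Δ)
  LSub-weakenL ([] e)       = [] (refl ∷ e)
  LSub-weakenL (unused s)   = unused (LSub-weakenL s)
  LSub-weakenL (used p d s) = used (skip p) (⊢-renL fresh d) (LSub-weakenL s)

  LSub-weakenU : ∀ {Ξ σ Γ Δ B} → LSub Ξ σ Γ Δ → LSub (B ∷ Ξ) (renU suc ∘ σ) Γ Δ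
  LSub-weakenU ([] e)       = [] e
  LSub-weakenU (unused s)   = unused (LSub-weakenU s)
  LSub-weakenU (used p d s) = used p (⊢-renU there d) (LSub-weakenU s)

  LSub-↑ : ∀ {Ξ σ Γ Δ} → LSub Ξ σ Γ Δ → LSub (↑Ξ Ξ) (renTm suc ∘ σ) (↑Γ Γ) (↑Γ Δ)
  LSub-↑ ([] e)       = [] (Empty-mapΓ e)
  LSub-↑ (unused s)   = unused (LSub-↑ s)
  LSub-↑ (used p d s) = used (⋈-mapΓ p) (⊢-renTm suc d) (LSub-↑ s)

  LSub-lift : ∀ {Ξ σ Γ Δ A} → LSub Ξ σ Γ Δ → LSub Ξ (extsL σ) (just A ∷ Γ) (just A ∷ Δ)
  LSub-lift {Δ = Δ} s = used (left (⋈-identityˡ Δ)) (ax (here (∅-Empty _))) (LSub-weakenL s)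

  LSub-id : ∀ {Ξ} Γ → LSub Ξ lv Γ Γ
  LSub-id []            = [] []
  LSub-id (nothing ∷ Γ) = unused (LSub-weakenL (LSub-id Γ))
  LSub-id (just A ∷ Γ)  =
    used (left (⋈-identityˡ Γ)) (ax (here (∅-Empty _))) (LSub-weakenL (LSub-id Γ))

  ⊢-subL : ∀ {Ξ σ Γ Δ t A} → LSub Ξ σ Γ Δ → Ξ ︔ Γ ⊢ t ∶ A → Ξ ︔ Δ ⊢ subL σ t ∶ A
  ⊢-subL s (ax l)       = LSub-LOnly s l
  ⊢-subL s (ax! x e)    = ax! x (LSub-Empty s e)
  ⊢-subL s (sum d e)    = sum (⊢-subL s d) (⊢-subL s e)
  ⊢-subL s (prod a d)   = prod a (⊢-subL s d)
  ⊢-subL s (𝟏i a e)     = 𝟏i a (LSub-Empty s e)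
  ⊢-subL s (𝟏e p d e) with LSub-⋈ s p
  ... | _ , _ , q , s₁ , s₂ = 𝟏e q (⊢-subL s₁ d) (⊢-subL s₂ e)
  ⊢-subL s (⊸i d)       = ⊸i (⊢-subL (LSub-lift s) d)
  ⊢-subL s (⊸e p d e) with LSub-⋈ s p
  ... | _ , _ , q , s₁ , s₂ = ⊸e q (⊢-subL s₁ d) (⊢-subL s₂ e)
  ⊢-subL s (⊗i p d e) with LSub-⋈ s p
  ... | _ , _ , q , s₁ , s₂ = ⊗i q (⊢-subL s₁ d) (⊢-subL s₂ e)
  ⊢-subL s (⊗e p d e) with LSub-⋈ s p
  ... | _ , _ , q , s₁ , s₂ = ⊗e q (⊢-subL s₁ d) (⊢-subL (LSub-lift (LSub-lift s₂)) e)
  ⊢-subL s ⊤i           = ⊤i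
  ⊢-subL s (𝟎e p d) with LSub-⋈ s p
  ... | _ , _ , q , s₁ , _ = 𝟎e q (⊢-subL s₁ d)
  ⊢-subL s (&i d e)     = &i (⊢-subL s d) (⊢-subL s e)
  ⊢-subL s (&e₁ p d e) with LSub-⋈ s p
  ... | _ , _ , q , s₁ , s₂ = &e₁ q (⊢-subL s₁ d) (⊢-subL (LSub-lift s₂) e)
  ⊢-subL s (&e₂ p d e) with LSub-⋈ s p
  ... | _ , _ , q , s₁ , s₂ = &e₂ q (⊢-subL s₁ d) (⊢-subL (LSub-lift s₂) e)
  ⊢-subL s (⊕i₁ d)      = ⊕i₁ (⊢-subL s d)
  ⊢-subL s (⊕i₂ d)      = ⊕i₂ (⊢-subL s d)
  ⊢-subL s (⊕e p d e f) with LSub-⋈ s p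
  ... | _ , _ , q , s₁ , s₂ = ⊕e q (⊢-subL s₁ d) (⊢-subL (LSub-lift s₂) e) (⊢-subL (LSub-lift s₂) f)
  ⊢-subL s (!i e d)     = !i (LSub-Empty s e) (⊢-subL s d)
  ⊢-subL s (!e p d e) with LSub-⋈ s p
  ... | _ , _ , q , s₁ , s₂ = !e q (⊢-subL s₁ d) (⊢-subL (LSub-weakenU s₂) e)
  ⊢-subL s (∀i d)       = ∀i (⊢-subL (LSub-↑ s) d)
  ⊢-subL s (∀e A d)     = ∀e A (⊢-subL s d)

  ⊢-[]L : ∀ {Ξ Γ Γ₁ Γ₂ t u A B} → Γ ≔ Γ₁ ⋈ Γ₂ →
          Ξ ︔ just A ∷ Γ₂ ⊢ t ∶ B → Ξ ︔ Γ₁ ⊢ u ∶ A → Ξ ︔ Γ ⊢ t [ u ]L ∶ B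
  ⊢-[]L {Γ₂ = Γ₂} p dt du = ⊢-subL (used p du (LSub-id Γ₂)) dt

  ⊢-[]L₂ : ∀ {Ξ Γ Γ₁ Γ₂ Γ₁₁ Γ₁₂ t u v A B C} → Γ ≔ Γ₁ ⋈ Γ₂ → Γ₁ ≔ Γ₁₁ ⋈ Γ₁₂ →
           Ξ ︔ just B ∷ just A ∷ Γ₂ ⊢ t ∶ C → Ξ ︔ Γ₁₁ ⊢ u ∶ A → Ξ ︔ Γ₁₂ ⊢ v ∶ B →
           Ξ ︔ Γ ⊢ subL (cons2L u v) t ∶ C
  ⊢-[]L₂ {Γ₂ = Γ₂} p q dt du dv with ⋈-assoc (⋈-comm p) q
  ... | _ , r , r' = ⊢-subL (used (⋈-comm r) dv (used (⋈-comm r') du (LSub-id Γ₂))) dt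

  -- n is the number of linear slots in scope; the substituted terms use none of them.
  NSub : UCtx → UCtx → (ℕ → Tm) → ℕ → Set c
  NSub Ξ Ξ' σ n = ∀ {i B} → UVar Ξ i B → Ξ' ︔ ∅ n ⊢ σ i ∶ B

  NSub-weakenL : ∀ {Ξ Ξ' σ n} → NSub Ξ Ξ' σ n → NSub Ξ Ξ' (renL suc ∘ σ) (suc n)
  NSub-weakenL h x = ⊢-renL fresh (h x)

  NSub-lift : ∀ {Ξ Ξ' σ n A} → NSub Ξ Ξ' σ n → NSub (A ∷ Ξ) (A ∷ Ξ') (extsU σ) n
  NSub-lift {n = n} h here      = ax! here (∅-Empty n)
  NSub-lift         h (there x) = ⊢-renU there (h x)

  NSub-↑ : ∀ {Ξ Ξ' σ n} → NSub Ξ Ξ' σ n → NSub (↑Ξ Ξ) (↑Ξ Ξ') (renTm suc ∘ σ) n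
  NSub-↑ {Ξ} {n = n} h x with UVar-map⁻ Ξ x
  ... | _ , y , refl =
    ⊢-cast refl (map-replicate (Maybe.map (renT suc)) n nothing) refl refl (⊢-renTm suc (h y))

  ⊢-subU : ∀ {Ξ Ξ' σ Γ n t A} → NSub Ξ Ξ' σ n → length Γ ≡ n →
           Ξ ︔ Γ ⊢ t ∶ A → Ξ' ︔ Γ ⊢ subU σ t ∶ A
  ⊢-subU h eq (ax l)       = ax l
  ⊢-subU h eq (ax! x e)    = ⊢-cast refl (sym (trans (Empty⇒≡∅ e) (cong ∅ eq))) refl refl (h x)
  ⊢-subU h eq (sum d e)    = sum (⊢-subU h eq d) (⊢-subU h eq e)
  ⊢-subU h eq (prod a d)   = prod a (⊢-subU h eq d)
  ⊢-subU h eq (𝟏i a e)     = 𝟏i a e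
  ⊢-subU h eq (𝟏e p d e)   =
    𝟏e p (⊢-subU h (trans (⋈-lengthˡ p) eq) d) (⊢-subU h (trans (⋈-lengthʳ p) eq) e)
  ⊢-subU h eq (⊸i d)       = ⊸i (⊢-subU (NSub-weakenL h) (cong suc eq) d)
  ⊢-subU h eq (⊸e p d e)   =
    ⊸e p (⊢-subU h (trans (⋈-lengthˡ p) eq) d) (⊢-subU h (trans (⋈-lengthʳ p) eq) e)
  ⊢-subU h eq (⊗i p d e)   =
    ⊗i p (⊢-subU h (trans (⋈-lengthˡ p) eq) d) (⊢-subU h (trans (⋈-lengthʳ p) eq) e)
  ⊢-subU h eq (⊗e p d e)   =
    ⊗e p (⊢-subU h (trans (⋈-lengthˡ p) eq) d)
         (⊢-subU (NSub-weakenL (NSub-weakenL h)) (cong (suc ∘ suc) (trans (⋈-lengthʳ p) eq)) e)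
  ⊢-subU h eq ⊤i           = ⊤i
  ⊢-subU h eq (𝟎e p d)     = 𝟎e p (⊢-subU h (trans (⋈-lengthˡ p) eq) d)
  ⊢-subU h eq (&i d e)     = &i (⊢-subU h eq d) (⊢-subU h eq e)
  ⊢-subU h eq (&e₁ p d e)  =
    &e₁ p (⊢-subU h (trans (⋈-lengthˡ p) eq) d)
          (⊢-subU (NSub-weakenL h) (cong suc (trans (⋈-lengthʳ p) eq)) e)
  ⊢-subU h eq (&e₂ p d e)  =
    &e₂ p (⊢-subU h (trans (⋈-lengthˡ p) eq) d)
          (⊢-subU (NSub-weakenL h) (cong suc (trans (⋈-lengthʳ p) eq)) e)
  ⊢-subU h eq (⊕i₁ d)      = ⊕i₁ (⊢-subU h eq d)
  ⊢-subU h eq (⊕i₂ d)      = ⊕i₂ (⊢-subU h eq d)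
  ⊢-subU h eq (⊕e p d e f) =
    ⊕e p (⊢-subU h (trans (⋈-lengthˡ p) eq) d)
         (⊢-subU (NSub-weakenL h) (cong suc (trans (⋈-lengthʳ p) eq)) e)
         (⊢-subU (NSub-weakenL h) (cong suc (trans (⋈-lengthʳ p) eq)) f)
  ⊢-subU h eq (!i e d)     = !i e (⊢-subU h eq d)
  ⊢-subU h eq (!e p d e)   =
    !e p (⊢-subU h (trans (⋈-lengthˡ p) eq) d) (⊢-subU (NSub-lift h) (trans (⋈-lengthʳ p) eq) e)
  ⊢-subU {Γ = Γ} h eq (∀i d) = ∀i (⊢-subU (NSub-↑ h) (trans (length-map _ Γ) eq) d)
  ⊢-subU h eq (∀e A d)     = ∀e A (⊢-subU h eq d)

  ⊢-[]U : ∀ {Ξ Γ Γ₁ Γ₂ t u A B} → Γ ≔ Γ₁ ⋈ Γ₂ → Empty Γ₁ →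
          A ∷ Ξ ︔ Γ₂ ⊢ t ∶ B → Ξ ︔ Γ₁ ⊢ u ∶ A → Ξ ︔ Γ ⊢ t [ u ]U ∶ B
  ⊢-[]U {Ξ} {Γ₂ = Γ₂} {u = u} {A} p e dt du =
    ⊢-cast refl (sym (⋈-emptyˡ p e)) refl refl (⊢-subU consU-typed refl dt)
    where
    du∅ : Ξ ︔ ∅ (length Γ₂) ⊢ u ∶ A
    du∅ = ⊢-cast refl (trans (Empty⇒≡∅ e) (cong ∅ (trans (⋈-lengthˡ p) (sym (⋈-lengthʳ p)))))
                 refl refl du
    consU-typed : NSub (A ∷ Ξ) Ξ (consU u) (length Γ₂)
    consU-typed here      = du∅
    consU-typed (there x) = ax! x (∅-Empty _)

  ⊢-[]Tm : ∀ {Ξ Γ t B} A → ↑Ξ Ξ ︔ ↑Γ Γ ⊢ t ∶ B → Ξ ︔ Γ ⊢ t [ A ]Tm ∶ B [ A ]T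
  ⊢-[]Tm {Ξ} {Γ} A d = ⊢-cast ([]T-↑Ξ A Ξ) ([]T-↑Γ A Γ) refl refl (⊢-subTm (consT A) d)

  subject-reduction : ∀ {Ξ Γ t u A} → Ξ ︔ Γ ⊢ t ∶ A → t ⟶ u → Ξ ︔ Γ ⊢ u ∶ A
  subject-reduction (𝟏e p (𝟏i a e) d) β𝟏 = ⊢-cast refl (sym (⋈-emptyˡ p e)) refl refl (prod a d)
  subject-reduction (⊸e p (⊸i d) e) β⊸ = ⊢-[]L (⋈-comm p) d e
  subject-reduction (⊗e p (⊗i q d₁ d₂) e) β⊗ = ⊢-[]L₂ p q e d₁ d₂
  subject-reduction (&e₁ p (&i d₁ d₂) e) β&₁ = ⊢-[]L p e d₁
  subject-reduction (&e₂ p (&i d₁ d₂) e) β&₂ = ⊢-[]L p e d₂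
  subject-reduction (⊕e p (⊕i₁ d) e f) β⊕₁ = ⊢-[]L p e d
  subject-reduction (⊕e p (⊕i₂ d) e f) β⊕₂ = ⊢-[]L p f d
  subject-reduction (!e p (!i e d) f) β! = ⊢-[]U p e f d
  subject-reduction (∀e A (∀i d)) β∀ = ⊢-[]Tm A d
  subject-reduction (sum (𝟏i a e) (𝟏i b _)) ⊞⋆ = 𝟏i _ e
  subject-reduction (sum (⊸i d) (⊸i e)) ⊞ƛ = ⊸i (sum d e)
  subject-reduction (⊗e p (sum d₁ d₂) e) ⊞δ⊗ = sum (⊗e p d₁ e) (⊗e p d₂ e)
  subject-reduction (sum ⊤i ⊤i) ⊞⟨⟩ = ⊤i
  subject-reduction (sum (&i d₁ d₂) (&i e₁ e₂)) ⊞⟨,⟩ = &i (sum d₁ e₁) (sum d₂ e₂)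
  subject-reduction (⊕e p (sum d₁ d₂) e f) ⊞δ⊕ = sum (⊕e p d₁ e f) (⊕e p d₂ e f)
  subject-reduction (sum (!i e d₁) (!i _ d₂)) ⊞! = !i e (sum d₁ d₂)
  subject-reduction (sum (∀i d₁) (∀i d₂)) ⊞Λ = ∀i (sum d₁ d₂)
  subject-reduction (prod a (𝟏i b e)) •⋆ = 𝟏i _ e
  subject-reduction (prod a (⊸i d)) •ƛ = ⊸i (prod a d)
  subject-reduction (⊗e p (prod a d) e) •δ⊗ = prod a (⊗e p d e)
  subject-reduction (prod a ⊤i) •⟨⟩ = ⊤i
  subject-reduction (prod a (&i d e)) •⟨,⟩ = &i (prod a d) (prod a e)
  subject-reduction (⊕e p (prod a d) e f) •δ⊕ = prod a (⊕e p d e f)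
  subject-reduction (prod a (!i e d)) •! = !i e (prod a d)
  subject-reduction (prod a (∀i d)) •Λ = ∀i (prod a d)
  subject-reduction (sum d e) (⊞₁ r) = sum (subject-reduction d r) e
  subject-reduction (sum d e) (⊞₂ r) = sum d (subject-reduction e r)
  subject-reduction (prod a d) (•c r) = prod a (subject-reduction d r)
  subject-reduction (𝟏e p d e) (δ𝟏₁ r) = 𝟏e p (subject-reduction d r) e
  subject-reduction (𝟏e p d e) (δ𝟏₂ r) = 𝟏e p d (subject-reduction e r)
  subject-reduction (⊸i d) (ƛc r) = ⊸i (subject-reduction d r)
  subject-reduction (⊸e p d e) ($₁ r) = ⊸e p (subject-reduction d r) e
  subject-reduction (⊸e p d e) ($₂ r) = ⊸e p d (subject-reduction e r)
  subject-reduction (⊗i p d e) (⊗₁ r) = ⊗i p (subject-reduction d r) e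
  subject-reduction (⊗i p d e) (⊗₂ r) = ⊗i p d (subject-reduction e r)
  subject-reduction (⊗e p d e) (δ⊗₁ r) = ⊗e p (subject-reduction d r) e
  subject-reduction (⊗e p d e) (δ⊗₂ r) = ⊗e p d (subject-reduction e r)
  subject-reduction (𝟎e p d) (δ𝟎c r) = 𝟎e p (subject-reduction d r)
  subject-reduction (&i d e) (⟨,⟩₁ r) = &i (subject-reduction d r) e
  subject-reduction (&i d e) (⟨,⟩₂ r) = &i d (subject-reduction e r)
  subject-reduction (&e₁ p d e) (δ&₁₁ r) = &e₁ p (subject-reduction d r) e
  subject-reduction (&e₁ p d e) (δ&₁₂ r) = &e₁ p d (subject-reduction e r)
  subject-reduction (&e₂ p d e) (δ&₂₁ r) = &e₂ p (subject-reduction d r) e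
  subject-reduction (&e₂ p d e) (δ&₂₂ r) = &e₂ p d (subject-reduction e r)
  subject-reduction (⊕i₁ d) (inlc r) = ⊕i₁ (subject-reduction d r)
  subject-reduction (⊕i₂ d) (inrc r) = ⊕i₂ (subject-reduction d r)
  subject-reduction (⊕e p d e f) (δ⊕₁ r) = ⊕e p (subject-reduction d r) e f
  subject-reduction (⊕e p d e f) (δ⊕₂ r) = ⊕e p d (subject-reduction e r) f
  subject-reduction (⊕e p d e f) (δ⊕₃ r) = ⊕e p d e (subject-reduction f r)
  subject-reduction (!i e d) (!c r) = !i e (subject-reduction d r)
  subject-reduction (!e p d e) (δ!₁ r) = !e p (subject-reduction d r) e
  subject-reduction (!e p d e) (δ!₂ r) = !e p d (subject-reduction e r)
  subject-reduction (∀i d) (Λc r) = ∀i (subject-reduction d r)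
  subject-reduction (∀e A d) (·T₁ r) = ∀e A (subject-reduction d r)

theorem1 : ∀ {c ℓ : Level} (S : Semiring c ℓ) (Ξ : UCtx) (Γ : LCtx)
             (t u : Calculus.Tm S) (A : Ty) →
             Calculus._︔_⊢_∶_ S Ξ Γ t A → Calculus._⟶_ S t u →
             Calculus._︔_⊢_∶_ S Ξ Γ u A
theorem1 S Ξ Γ t u A = SubjectReduction.subject-reduction S
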